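{- Let $\Omega$ be an infinite set, $G=S_\Omega$ its symmetric group, and $\mathcal G$ the symmetric group on $\mathcal P(\Omega)$ with the product (pointwise convergence) topology. For $g\in G$ let $g^*\in\mathcal G$ be given by $g^*A=\{ga: a\in A\}$. Then $G^*=\{g^*: g\in G\}$ is a closed subgroup of $\mathcal G$.
   Context: The product topology on $\mathcal G$ (with $\mathcal P(\Omega)$ discrete) has as basic open sets the sets $\{h\in\mathcal G: hA_i=B_i \text{ for } i\le n\}$ for finitely many $A_0,\dots,A_n,B_0,\dots,B_n\subseteq\Omega$. -}

module Defs where

open import Level using (Level; suc; zero)
open import Data.Nat using (ℕ)
open import Data.Product using (Σ; _×_; _,_; proj₁; proj₂)
open import Data.List using (List)
open import Data.List.Relation.Unary.All using (All)
open import Relation.Binary.Bundles using (Setoid)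
open import Relation.Binary.PropositionalEquality using (_≡_; refl; sym; trans; cong)
import Relation.Binary.PropositionalEquality as PE
open import Function.Bundles using (Inverse; _↔_; Injection)
import Function.Construct.Composition as Comp
import Function.Construct.Identity as Ident
import Function.Construct.Symmetry as Symm

𝒫 : Set → Set₁
𝒫 Ω = Ω → Set

_≐_ : {Ω : Set} → 𝒫 Ω → 𝒫 Ω → Set
A ≐ B = ∀ x → (A x → B x) × (B x → A x)

≐-refl : {Ω : Set} {A : 𝒫 Ω} → A ≐ A
≐-refl x = (λ a → a) , (λ a → a)

≐-sym : {Ω : Set} {A B : 𝒫 Ω} → A ≐ B → B ≐ A
≐-sym p x = proj₂ (p x) , proj₁ (p x)

≐-trans : {Ω : Set} {A B C : 𝒫 Ω} → A ≐ B → B ≐ C → A ≐ C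
≐-trans p q x = (λ a → proj₁ (q x) (proj₁ (p x) a)) , (λ c → proj₂ (p x) (proj₂ (q x) c))

𝒫-setoid : Set → Setoid (suc zero) zero
𝒫-setoid Ω = record
  { Carrier = 𝒫 Ω
  ; _≈_ = _≐_
  ; isEquivalence = record { refl = ≐-refl ; sym = ≐-sym ; trans = ≐-trans }
  }

Infinite : Set → Set
Infinite Ω = Injection (PE.setoid ℕ) (PE.setoid Ω)

Sym : Set → Set
Sym Ω = Ω ↔ Ω

𝒢 : Set → Set₁
𝒢 Ω = Inverse (𝒫-setoid Ω) (𝒫-setoid Ω)

id𝒢 : {Ω : Set} → 𝒢 Ω
id𝒢 {Ω} = Ident.inverse (𝒫-setoid Ω)

_∘𝒢_ : {Ω : Set} → 𝒢 Ω → 𝒢 Ω → 𝒢 Ω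
h ∘𝒢 k = Comp.inverse k h     -- (h ∘ k) A = h (k A)

_⁻¹𝒢 : {Ω : Set} → 𝒢 Ω → 𝒢 Ω
h ⁻¹𝒢 = Symm.inverse h

_≈𝒢_ : {Ω : Set} → 𝒢 Ω → 𝒢 Ω → Set₁
_≈𝒢_ {Ω} h k = (A : 𝒫 Ω) → Inverse.to h A ≐ Inverse.to k A

image : {Ω : Set} → (Ω → Ω) → 𝒫 Ω → 𝒫 Ω
image {Ω} f A b = Σ Ω (λ a → A a × f a ≡ b)

image-cong : {Ω : Set} (f : Ω → Ω) {A B : 𝒫 Ω} → A ≐ B → image f A ≐ image f B
image-cong f p b = (λ { (a , x , e) → a , proj₁ (p a) x , e })
                 , (λ { (a , x , e) → a , proj₂ (p a) x , e })

module _ {Ω : Set} (g : Sym Ω) where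
  private
    f = Inverse.to g
    f⁻ = Inverse.from g

  private
    back : ∀ (A : 𝒫 Ω) → image f⁻ (image f A) ≐ A
    back A x = (λ { (y , (a , ax , refl) , refl) →
                     PE.subst A (sym (Inverse.strictlyInverseʳ g a)) ax })
             , (λ ax → f x , (x , ax , refl) , Inverse.strictlyInverseʳ g x)

    back' : ∀ (A : 𝒫 Ω) → image f (image f⁻ A) ≐ A
    back' A x = (λ { (y , (a , ax , refl) , refl) →
                      PE.subst A (sym (Inverse.strictlyInverseˡ g a)) ax })
              , (λ ax → f⁻ x , (x , ax , refl) , Inverse.strictlyInverseˡ g x)

  star : 𝒢 Ω
  star = record
    { to = image f
    ; from = image f⁻
    ; to-cong = image-cong f
    ; from-cong = image-cong f⁻
    ; inverse = (λ {A} {B} p → ≐-trans (image-cong f p) (back' A))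
              , (λ {A} {B} p → ≐-trans (image-cong f⁻ p) (back A))
    }

G* : (Ω : Set) → 𝒢 Ω → Set₁
G* Ω h = Σ (Sym Ω) (λ g → h ≈𝒢 star g)

IsSubgroup : {Ω : Set} → (𝒢 Ω → Set₁) → Set₁
IsSubgroup {Ω} S =
    S id𝒢
  × ((h k : 𝒢 Ω) → S h → S k → S (h ∘𝒢 k))
  × ((h : 𝒢 Ω) → S h → S (h ⁻¹𝒢))

-- Product topology on 𝒢 (𝒫(Ω) discrete): a basic open set is given by a finite list
-- of pairs (A_i , B_i), namely { h : h A_i = B_i for all i }.
BasicOpen : Set → Set₁
BasicOpen Ω = List (𝒫 Ω × 𝒫 Ω)

_∈B_ : {Ω : Set} → 𝒢 Ω → BasicOpen Ω → Set₁
h ∈B U = All (λ p → Inverse.to h (proj₁ p) ≐ proj₂ p) U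

Closure : {Ω : Set} → (𝒢 Ω → Set₁) → 𝒢 Ω → Set₁
Closure {Ω} S h = (U : BasicOpen Ω) → h ∈B U → Σ (𝒢 Ω) (λ k → S k × k ∈B U)

IsClosed : {Ω : Set} → (𝒢 Ω → Set₁) → Set₁
IsClosed {Ω} S = (h : 𝒢 Ω) → Closure S h → S h

-- A permutation h of 𝒫(Ω) in the closure of G* agrees on each finite family of subsets with some g*.
-- Taking singletons shows that h and h⁻¹ send points to points, so h induces a permutation f of Ω
-- with h{c} = {f c}. To see that h A = f* A at a point x, approximate h simultaneously on A and on
-- {f⁻¹ x} by some g*: then g (f⁻¹ x) = x, so x ∈ h A ⇔ x ∈ g* A ⇔ f⁻¹ x ∈ A ⇔ x ∈ f* A.
module Submission where

open import Defs
open import Data.Product using (_×_; Σ; _,_; proj₁; proj₂)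
open import Data.List using (List; []; _∷_; map)
open import Data.List.Relation.Unary.All as All using (All; []; _∷_; universal)
open import Data.List.Relation.Unary.All.Properties using (map⁺; map⁻)
open import Relation.Binary.PropositionalEquality using (_≡_; refl; sym; trans; cong; subst)
open import Relation.Unary using (｛_｝)
open import Function.Bundles using (Inverse; mk↔ₛ′)
open import Function.Construct.Identity using (↔-id)
open import Function.Construct.Composition using (_↔-∘_)
open import Function.Construct.Symmetry using (↔-sym)

open Inverse using (to; from; inverseˡ; inverseʳ; strictlyInverseˡ; strictlyInverseʳ)

module _ {Ω : Set} where

  image-id : (A : 𝒫 Ω) → image (λ x → x) A ≐ A
  image-id A x = (λ { (a , a∈A , refl) → a∈A }) , (λ x∈A → x , x∈A , refl)

  image-∘ : (f f′ : Ω → Ω) (A : 𝒫 Ω) → image (λ x → f (f′ x)) A ≐ image f (image f′ A)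
  image-∘ f f′ A x = (λ { (a , a∈A , refl) → f′ a , (a , a∈A , refl) , refl })
                   , (λ { (_ , (a , a∈A , refl) , refl) → a , a∈A , refl })

  image-｛｝ : (f : Ω → Ω) (c : Ω) → image f ｛ c ｝ ≐ ｛ f c ｝
  image-｛｝ f c x = (λ { (_ , refl , fc≡x) → fc≡x }) , (λ fc≡x → c , refl , fc≡x)

  ｛｝-injective : {x y : Ω} → ｛ x ｝ ≐ ｛ y ｝ → x ≡ y
  ｛｝-injective {y = y} p = proj₂ (p y) refl

  image-↔ : (g : Sym Ω) (A : 𝒫 Ω) → image (to g) A ≐ (λ x → A (from g x))
  image-↔ g A x =
      (λ { (a , a∈A , refl) → subst A (sym (strictlyInverseʳ g a)) a∈A })
    , (λ g⁻¹x∈A → from g x , g⁻¹x∈A , strictlyInverseˡ g x)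

  G*-id : G* Ω id𝒢
  G*-id = ↔-id Ω , λ A → ≐-sym (image-id A)

  G*-∘ : (h k : 𝒢 Ω) → G* Ω h → G* Ω k → G* Ω (h ∘𝒢 k)
  G*-∘ h k (g , h≈g*) (g′ , k≈g′*) = g ↔-∘ g′ , λ A →
    ≐-trans (h≈g* (to k A))
            (≐-trans (image-cong (to g) (k≈g′* A)) (≐-sym (image-∘ (to g) (to g′) A)))

  G*-⁻¹ : (h : 𝒢 Ω) → G* Ω h → G* Ω (h ⁻¹𝒢)
  G*-⁻¹ h (g , h≈g*) = ↔-sym g , λ A →
    ≐-sym (inverseʳ (star g) (≐-sym (≐-trans (≐-sym (h≈g* (from h A))) (strictlyInverseˡ h A))))

  G*-isSubgroup : IsSubgroup (G* Ω)
  G*-isSubgroup = G*-id , G*-∘ , G*-⁻¹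

  approximate : {h : 𝒢 Ω} → Closure (G* Ω) h → (As : List (𝒫 Ω)) →
                Σ (Sym Ω) (λ g → All (λ A → image (to g) A ≐ to h A) As)
  approximate {h} h∈cl As
    with h∈cl (map (λ A → A , to h A) As) (map⁺ (universal (λ _ → ≐-refl) As))
  ... | _ , (g , k≈g*) , k∈U = g , All.map (≐-trans (≐-sym (k≈g* _))) (map⁻ k∈U)

  module InducedPermutation (h : 𝒢 Ω)
                  (to-｛｝ : ∀ c → Σ Ω (λ y → to h ｛ c ｝ ≐ ｛ y ｝))
                  (from-｛｝ : ∀ b → Σ Ω (λ y → from h ｛ b ｝ ≐ ｛ y ｝)) where

    perm : Sym Ω
    perm = mk↔ₛ′ (λ c → proj₁ (to-｛｝ c)) (λ b → proj₁ (from-｛｝ b))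
      (λ b → ｛｝-injective (≐-trans (≐-sym (proj₂ (to-｛｝ _)))
                                     (inverseˡ h (≐-sym (proj₂ (from-｛｝ b))))))
      (λ c → ｛｝-injective (≐-trans (≐-sym (proj₂ (from-｛｝ _)))
                                     (inverseʳ h (≐-sym (proj₂ (to-｛｝ c))))))

    to-｛｝-perm : ∀ c → to h ｛ c ｝ ≐ ｛ to perm c ｝
    to-｛｝-perm c = proj₂ (to-｛｝ c)

  module _ (h : 𝒢 Ω) (h∈cl : Closure (G* Ω) h) where

    closure-to-｛｝ : ∀ c → Σ Ω (λ y → to h ｛ c ｝ ≐ ｛ y ｝)
    closure-to-｛｝ c with approximate {h} h∈cl (｛ c ｝ ∷ [])
    ... | g , g*c≐hc ∷ [] = to g c , ≐-trans (≐-sym g*c≐hc) (image-｛｝ (to g) c)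

    closure-from-｛｝ : ∀ b → Σ Ω (λ y → from h ｛ b ｝ ≐ ｛ y ｝)
    closure-from-｛｝ b with approximate {h} h∈cl (from h ｛ b ｝ ∷ [])
    ... | g , g*A≐hA ∷ [] =
      from g b ,
      ≐-trans (≐-sym (inverseʳ (star g) (≐-sym (≐-trans g*A≐hA (strictlyInverseˡ h ｛ b ｝)))))
              (image-｛｝ (from g) b)

    open InducedPermutation h closure-to-｛｝ closure-from-｛｝ public

    closure-star : h ≈𝒢 star perm
    closure-star A x with approximate {h} h∈cl (A ∷ ｛ from perm x ｝ ∷ [])
    ... | g , g*A≐hA ∷ g*y≐hy ∷ [] =
        (λ x∈hA → proj₂ (image-↔ perm A x)
                    (subst A g⁻¹x≡y (proj₁ (image-↔ g A x) (proj₂ (g*A≐hA x) x∈hA))))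
      , (λ x∈perm*A → proj₁ (g*A≐hA x)
                    (proj₂ (image-↔ g A x)
                      (subst A (sym g⁻¹x≡y) (proj₁ (image-↔ perm A x) x∈perm*A))))
      where
      y : Ω
      y = from perm x

      g-y≡x : to g y ≡ x
      g-y≡x = trans (｛｝-injective (≐-trans (≐-sym (image-｛｝ (to g) y))
                                           (≐-trans g*y≐hy (to-｛｝-perm y))))
                    (strictlyInverseˡ perm x)

      g⁻¹x≡y : from g x ≡ y
      g⁻¹x≡y = trans (cong (from g) (sym g-y≡x)) (strictlyInverseʳ g y)

  G*-isClosed : IsClosed (G* Ω)
  G*-isClosed h h∈cl = perm h h∈cl , closure-star h h∈cl

lemma6 : (Ω : Set) → Infinite Ω → IsSubgroup (G* Ω) × IsClosed (G* Ω)
lemma6 Ω _ = G*-isSubgroup , G*-isClosed
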